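{- For every integer $n\ge 13$, $\gamma^{\mathrm{LOC}}(\mathrm{C}_n(1,3))\ge n/3$.
   Context: For an integer $n\ge 7$, the circulant graph $\mathrm{C}_n(1,3)$ has vertex set $\mathbb{Z}_n$, with $x,y$ adjacent iff $x-y\equiv \pm1$ or $\pm3 \pmod n$. For a graph $G=(V,E)$ and $u\in V$, $N[u]$ is the closed neighbourhood of $u$, and for $S\subseteq V$, $S_u=N[u]\cap S$. A set $S\subseteq V$ is a locating code if the sets $S_u$, $u\in V\setminus S$, are all nonempty and pairwise distinct. $\gamma^{\mathrm{LOC}}(G)$ is the minimum size of a locating code of $G$. -}

module Defs where

open import Data.Nat using (ℕ; _+_; _∸_; _%_; NonZero)
open import Data.Fin using (Fin; toℕ)
open import Data.Fin.Subset using (Subset; _∈_; _∉_; _∩_; ⁅_⁆; Nonempty)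
open import Data.Vec using (tabulate)
open import Data.Bool using (Bool; true; false; _∨_)
open import Data.Nat using (_≡ᵇ_)
open import Relation.Binary.PropositionalEquality using (_≡_; _≢_)
open import Data.Product using (_×_)

diffMod : (n : ℕ) → .{{NonZero n}} → Fin n → Fin n → ℕ
diffMod n x y = (toℕ x + n ∸ toℕ y) % n

adjᵇ : (n : ℕ) → .{{NonZero n}} → Fin n → Fin n → Bool
adjᵇ n x y =
  let d = diffMod n x y in
  (d ≡ᵇ 1) ∨ (d ≡ᵇ 3) ∨ (d ≡ᵇ (n ∸ 1)) ∨ (d ≡ᵇ (n ∸ 3))

closedNbhd : (n : ℕ) → .{{NonZero n}} → Fin n → Subset n
closedNbhd n u = tabulate λ v → (diffMod n v u ≡ᵇ 0) ∨ adjᵇ n u v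

trace : (n : ℕ) → .{{NonZero n}} → Subset n → Fin n → Subset n
trace n S u = closedNbhd n u ∩ S

IsLocatingCode : (n : ℕ) → .{{NonZero n}} → Subset n → Set
IsLocatingCode n S =
  ((u : Fin n) → u ∉ S → Nonempty (trace n S u)) ×
  ((u v : Fin n) → u ∉ S → v ∉ S → u ≢ v → trace n S u ≢ trace n S v)

-- Record the code as the bit sequence q ↦ [q mod n ∈ S] and look at it through a window of
-- eleven consecutive positions p, …, p + 10.  If the vertex p + 7 is not a codeword, it must be
-- dominated and must be separated from the non-codewords p + 5 and p + 3; each of these forces a
-- codeword into an explicit set of window positions.  An exhaustive check over
-- all 2¹¹ windows shows that a potential on 10-bit windows drops by at least one at every shift,
-- except that a codeword entering the window may raise it by up to three.  Around the cycle the
-- potential returns to its initial value, so n shifts cost at most 3 ∣ S ∣.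

module Submission where

open import Defs
import Data.Nat
open import Data.Bool using (Bool; true; false; T; _∧_; _∨_; if_then_else_)
open import Data.Bool.ListAction using (any; or)
open import Data.Bool.Properties using (T-≡; T-∨; T-∧; ∨-identityʳ; ∧-conicalˡ; ∧-conicalʳ)
open import Data.Empty using (⊥-elim)
open import Data.Fin using (Fin; toℕ)
import Data.Fin as Fin
open import Data.Fin.Properties using (toℕ-injective; toℕ-fromℕ<; toℕ<n)
open import Data.Fin.Subset using (Subset; _∈_; _∉_; _∩_; _⊆_; ∣_∣)
open import Data.Fin.Subset.Properties using (⊆-antisym; x∈p∩q⁺; x∈p∩q⁻; p∩q⊆q)
open import Data.List using (List; []; _∷_; [_]; _++_; filter; applyUpTo)
open import Data.List.Membership.DecPropositional Data.Nat._≟_ using (_∈?_; _∉?_)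
open import Data.List.Membership.Propositional using (find; lose) renaming (_∈_ to _∈ₗ_; _∉_ to _∉ₗ_)
open import Data.List.Membership.Propositional.Properties using (∈-filter⁺; ∈-++⁺ˡ; ∈-++⁺ʳ)
open import Data.List.Properties using (applyUpTo-∷ʳ)
open import Data.List.Relation.Unary.Any using (Any; here; there; any?)
import Data.List.Relation.Unary.Any as Any
open import Data.List.Relation.Unary.Any.Properties using (any⁺; any⁻)
open import Data.Nat using (ℕ; zero; suc; _+_; _*_; _∸_; _%_; _⊓_; _<_; _≤_; _≡ᵇ_; _<ᵇ_; NonZero; >-nonZero⁻¹; z≤n; s≤s)
open import Data.Nat.DivMod using (_mod_; %-distribˡ-+; m%n%n≡m%n; [m+n]%n≡m%n; m%n<n; m%n≤n; m<n⇒m%n≡m; n%n≡0)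
open import Data.Nat.ListAction using (sum)
open import Data.Nat.ListAction.Properties using (sum-++)
open import Data.Nat.Properties
open import Data.Product using (_×_; _,_; proj₁; proj₂)
open import Data.Sum using (_⊎_; inj₁; inj₂)
open import Data.Vec using (Vec; []; _∷_; tabulate; lookup; init; last; tail)
open import Data.Vec.Properties using (lookup∘tabulate; tabulate-cong; []=⇒lookup; lookup⇒[]=)
open import Function using (_⇔_; mk⇔; Equivalence; _∘_)
open import Relation.Binary.PropositionalEquality using (_≡_; _≢_; refl; sym; trans; cong; cong₂; subst; subst₂; module ≡-Reasoning)
open import Relation.Nullary using (¬_; yes; no)
open import Relation.Nullary.Decidable using (True; False; toWitness; toWitnessFalse; decidable-stable; from-yes; T?)

-- Amortisation along a cycle

𝟙 : Bool → ℕ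
𝟙 true  = 1
𝟙 false = 0

sum-applyUpTo-suc : ∀ (f : ℕ → ℕ) m → sum (applyUpTo f (suc m)) ≡ sum (applyUpTo f m) + f m
sum-applyUpTo-suc f m = begin
  sum (applyUpTo f (suc m))         ≡⟨ cong sum (applyUpTo-∷ʳ f m) ⟨
  sum (applyUpTo f m ++ [ f m ])    ≡⟨ sum-++ (applyUpTo f m) [ f m ] ⟩
  sum (applyUpTo f m) + (f m + 0)   ≡⟨ cong (sum (applyUpTo f m) +_) (+-identityʳ (f m)) ⟩
  sum (applyUpTo f m) + f m         ∎
  where open ≡-Reasoning

sum-applyUpTo-rotate : ∀ (f : ℕ → ℕ) m → (∀ i → f (m + i) ≡ f i) →
                       ∀ k → sum (applyUpTo (λ i → f (k + i)) m) ≡ sum (applyUpTo f m)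
sum-applyUpTo-rotate f m periodic zero    = refl
sum-applyUpTo-rotate f m periodic (suc k) =
  trans (sum-applyUpTo-rotate (f ∘ suc) m periodic-suc k) (+-cancelʳ-≡ (f 0) _ _ rotate-once)
  where
    open ≡-Reasoning
    periodic-suc : ∀ i → f (suc (m + i)) ≡ f (suc i)
    periodic-suc i = trans (cong f (sym (+-suc m i))) (periodic (suc i))
    rotate-once : sum (applyUpTo (f ∘ suc) m) + f 0 ≡ sum (applyUpTo f m) + f 0
    rotate-once = begin
      sum (applyUpTo (f ∘ suc) m) + f 0   ≡⟨ +-comm _ (f 0) ⟩
      sum (applyUpTo f (suc m))           ≡⟨ sum-applyUpTo-suc f m ⟩
      sum (applyUpTo f m) + f m           ≡⟨ cong (λ i → sum (applyUpTo f m) + f i) (+-identityʳ m) ⟨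
      sum (applyUpTo f m) + f (m + 0)     ≡⟨ cong (sum (applyUpTo f m) +_) (periodic 0) ⟩
      sum (applyUpTo f m) + f 0           ∎

sum-applyUpTo-count : ∀ {m} (U : Subset m) (f : ℕ → ℕ) → (∀ i → f (toℕ i) ≡ 𝟙 (lookup U i)) →
                      sum (applyUpTo f m) ≡ ∣ U ∣
sum-applyUpTo-count []          f eq = refl
sum-applyUpTo-count (true ∷ U)  f eq =
  cong₂ _+_ (eq Fin.zero) (sum-applyUpTo-count U (f ∘ suc) (eq ∘ Fin.suc))
sum-applyUpTo-count (false ∷ U) f eq =
  cong₂ _+_ (eq Fin.zero) (sum-applyUpTo-count U (f ∘ suc) (eq ∘ Fin.suc))

potential-telescope : ∀ c (Φ g : ℕ → ℕ) → (∀ p → Φ (suc p) < Φ p + c * g p) →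
                      ∀ m → Φ m + m ≤ Φ 0 + c * sum (applyUpTo g m)
potential-telescope c Φ g step zero    = ≤-reflexive (cong (Φ 0 +_) (sym (*-zeroʳ c)))
potential-telescope c Φ g step (suc m) = begin
  Φ (suc m) + suc m         ≡⟨ +-suc (Φ (suc m)) m ⟩
  suc (Φ (suc m) + m)       ≤⟨ s≤s (potential-telescope c (Φ ∘ suc) (g ∘ suc) (step ∘ suc) m) ⟩
  suc (Φ 1) + c * s         ≤⟨ +-monoˡ-≤ (c * s) (step 0) ⟩
  Φ 0 + c * g 0 + c * s     ≡⟨ +-assoc (Φ 0) (c * g 0) (c * s) ⟩
  Φ 0 + (c * g 0 + c * s)   ≡⟨ cong (Φ 0 +_) (*-distribˡ-+ c (g 0) s) ⟨
  Φ 0 + c * (g 0 + s)       ∎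
  where
    open ≤-Reasoning
    s = sum (applyUpTo (g ∘ suc) m)

cyclic-potential-bound : ∀ c (Φ g : ℕ → ℕ) → (∀ p → Φ (suc p) < Φ p + c * g p) →
                         ∀ m → Φ m ≡ Φ 0 → m ≤ c * sum (applyUpTo g m)
cyclic-potential-bound c Φ g step m Φm≡Φ0 = +-cancelˡ-≤ (Φ 0) m _
  (subst (λ x → x + m ≤ Φ 0 + c * sum (applyUpTo g m)) Φm≡Φ0 (potential-telescope c Φ g step m))

∈⇔T-lookup : ∀ {n} (p : Subset n) {z} → z ∈ p ⇔ T (lookup p z)
∈⇔T-lookup p {z} = mk⇔
  (λ z∈ → Equivalence.from T-≡ ([]=⇒lookup z∈))
  (λ t → lookup⇒[]= z p (Equivalence.to T-≡ t))

∈-tabulate⇔ : ∀ {n} (f : Fin n → Bool) {z} → z ∈ tabulate f ⇔ T (f z)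
∈-tabulate⇔ f {z} =
  subst (λ b → z ∈ tabulate f ⇔ T b) (lookup∘tabulate f z) (∈⇔T-lookup (tabulate f))

∩-≡ : ∀ {n} {p q r : Subset n} → p ∩ r ⊆ q → q ∩ r ⊆ p → p ∩ r ≡ q ∩ r
∩-≡ {p = p} {q} {r} p∩r⊆q q∩r⊆p = ⊆-antisym
  (λ x∈ → x∈p∩q⁺ (p∩r⊆q x∈ , p∩q⊆q p r x∈))
  (λ x∈ → x∈p∩q⁺ (q∩r⊆p x∈ , p∩q⊆q q r x∈))

_∖_ : List ℕ → List ℕ → List ℕ
xs ∖ ys = filter (_∉? ys) xs

_△_ : List ℕ → List ℕ → List ℕ
xs △ ys = xs ∖ ys ++ ys ∖ xs

nbrs : ℕ → List ℕ
nbrs c = c ∸ 3 ∷ c ∸ 1 ∷ c ∷ c + 1 ∷ c + 3 ∷ []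

-- The potential certificate

-- The three lists are nbrs 7, nbrs 7 △ nbrs 5 and nbrs 7 △ nbrs 3 (window-locallyLocating
-- checks this by normalisation); they are written out so that the exhaustive check stays fast.
locallyLocating : Vec Bool 11 → Bool
locallyLocating (y₀ ∷ y₁ ∷ y₂ ∷ y₃ ∷ y₄ ∷ y₅ ∷ y₆ ∷ y₇ ∷ y₈ ∷ y₉ ∷ y₁₀ ∷ []) =
  or (y₄ ∷ y₆ ∷ y₇ ∷ y₈ ∷ y₁₀ ∷ []) ∧
  or (y₇ ∷ y₁₀ ∷ y₂ ∷ y₅ ∷ []) ∧
  or (y₇ ∷ y₈ ∷ y₁₀ ∷ y₀ ∷ y₂ ∷ y₃ ∷ [])

Table : ℕ → Set
Table zero    = ℕ
Table (suc k) = Table k × Table k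

_!_ : ∀ {k} → Table k → Vec Bool k → ℕ
t       ! []          = t
(t , _) ! (true ∷ w)  = t ! w
(_ , f) ! (false ∷ w) = f ! w

tabulateᵀ : ∀ {k} → (Vec Bool k → ℕ) → Table k
tabulateᵀ {zero}  φ = φ []
tabulateᵀ {suc k} φ = tabulateᵀ (λ w → φ (true ∷ w)) , tabulateᵀ (λ w → φ (false ∷ w))

-- potential w is 6 minus the largest deficit (number of shifts minus three times the number of
-- codewords entering) of a run of admissible windows ending in w; eleven rounds of Bellman–Ford
-- relaxation from the constant 6 reach this fixed point.
relax : (Vec Bool 10 → ℕ) → Vec Bool 10 → ℕ
relax φ w = 6 ⊓ via true ⊓ via false
  where
    via : Bool → ℕ
    via b = if locallyLocating (b ∷ w) then φ (b ∷ init w) + 3 * 𝟙 (last w) ∸ 1 else 6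

-- A separate function, so that the previous table is evaluated once rather than at every entry.
relaxTable : Table 10 → Table 10
relaxTable t = tabulateᵀ (relax (t !_))

potentialTable : ℕ → Table 10
potentialTable zero    = tabulateᵀ (λ _ → 6)
potentialTable (suc k) = relaxTable (potentialTable k)

potential : Vec Bool 10 → ℕ
potential w = potentialTable 11 ! w

everyVec : ∀ {k} → (Vec Bool k → Bool) → Bool
everyVec {zero}  P = P []
everyVec {suc k} P = everyVec (λ w → P (true ∷ w)) ∧ everyVec (λ w → P (false ∷ w))

everyVec-sound : ∀ {k} (P : Vec Bool k → Bool) → everyVec P ≡ true → ∀ w → P w ≡ true
everyVec-sound {zero}  P holds []          = holds
everyVec-sound {suc k} P holds (true ∷ w)  =
  everyVec-sound (λ w → P (true ∷ w)) (∧-conicalˡ _ _ holds) w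
everyVec-sound {suc k} P holds (false ∷ w) =
  everyVec-sound (λ w → P (false ∷ w)) (∧-conicalʳ _ _ holds) w

potentialDecreases : Table 10 → Vec Bool 11 → Bool
potentialDecreases t y = if locallyLocating y then t ! tail y <ᵇ t ! init y + 3 * 𝟙 (last y) else true

-- Stated as an equation rather than as T (everyVec …), whose every comparison would re-run the check.
potentialDecreases-everywhere : everyVec (potentialDecreases (potentialTable 11)) ≡ true
potentialDecreases-everywhere = refl

if-true : ∀ b {x} → T b → (if b then x else true) ≡ true → T x
if-true true _ refl = _

potential-step : ∀ y → T (locallyLocating y) →
                 potential (tail y) < potential (init y) + 3 * 𝟙 (last y)
potential-step y loc = <ᵇ⇒< _ _ (if-true (locallyLocating y) loc
  (everyVec-sound (potentialDecreases (potentialTable 11)) potentialDecreases-everywhere y))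

-- Arithmetic modulo n and closed neighbourhoods in C_n(1,3)

module _ {n : ℕ} .{{_ : NonZero n}} where

  open ≡-Reasoning

  [m%n+k]%n≡[m+k]%n : ∀ m k → (m % n + k) % n ≡ (m + k) % n
  [m%n+k]%n≡[m+k]%n m k = begin
    (m % n + k) % n           ≡⟨ %-distribˡ-+ (m % n) k n ⟩
    (m % n % n + k % n) % n   ≡⟨ cong (λ r → (r + k % n) % n) (m%n%n≡m%n m n) ⟩
    (m % n + k % n) % n       ≡⟨ %-distribˡ-+ m k n ⟨
    (m + k) % n               ∎

  [m+k%n]%n≡[m+k]%n : ∀ m k → (m + k % n) % n ≡ (m + k) % n
  [m+k%n]%n≡[m+k]%n m k = begin
    (m + k % n) % n   ≡⟨ cong (_% n) (+-comm m (k % n)) ⟩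
    (k % n + m) % n   ≡⟨ [m%n+k]%n≡[m+k]%n k m ⟩
    (k + m) % n       ≡⟨ cong (_% n) (+-comm k m) ⟩
    (m + k) % n       ∎

  -- Adding n ∸ k % n undoes adding k.
  %-cancelʳ-+ : ∀ k a b → (a + k) % n ≡ (b + k) % n → a % n ≡ b % n
  %-cancelʳ-+ k a b eq = begin
    a % n                         ≡⟨ undo a ⟨
    ((a + k) % n + k′) % n        ≡⟨ cong (λ r → (r + k′) % n) eq ⟩
    ((b + k) % n + k′) % n        ≡⟨ undo b ⟩
    b % n                         ∎
    where
      k′ = n ∸ k % n
      undo : ∀ m → ((m + k) % n + k′) % n ≡ m % n
      undo m = begin
        ((m + k) % n + k′) % n        ≡⟨ [m%n+k]%n≡[m+k]%n (m + k) k′ ⟩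
        (m + k + k′) % n              ≡⟨ cong (_% n) (+-assoc m k k′) ⟩
        (m + (k + k′)) % n            ≡⟨ [m+k%n]%n≡[m+k]%n m (k + k′) ⟨
        (m + (k + k′) % n) % n        ≡⟨ cong (λ r → (m + r) % n) ([m%n+k]%n≡[m+k]%n k k′) ⟨
        (m + (k % n + k′) % n) % n    ≡⟨ cong (λ r → (m + r % n) % n) (m+[n∸m]≡n (m%n≤n k n)) ⟩
        (m + n % n) % n               ≡⟨ cong (λ r → (m + r) % n) (n%n≡0 n) ⟩
        (m + 0) % n                   ≡⟨ cong (_% n) (+-identityʳ m) ⟩
        m % n                         ∎

  %-cancelˡ-+ : ∀ k a b → (k + a) % n ≡ (k + b) % n → a % n ≡ b % n
  %-cancelˡ-+ k a b eq =
    %-cancelʳ-+ k a b (subst₂ (λ l r → l % n ≡ r % n) (+-comm k a) (+-comm k b) eq)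

  toℕ-mod : ∀ a → toℕ (a mod n) ≡ a % n
  toℕ-mod a = toℕ-fromℕ< (m%n<n a n)

  toℕ-%-id : ∀ (z : Fin n) → toℕ z % n ≡ toℕ z
  toℕ-%-id z = m<n⇒m%n≡m (toℕ<n z)

  mod-cong : ∀ a b → a % n ≡ b % n → a mod n ≡ b mod n
  mod-cong a b eq = toℕ-injective (trans (toℕ-mod a) (trans eq (sym (toℕ-mod b))))

  toℕ-mod-id : ∀ (z : Fin n) → toℕ z mod n ≡ z
  toℕ-mod-id z = toℕ-injective (trans (toℕ-mod (toℕ z)) (toℕ-%-id z))

  mod-≡ : ∀ (z : Fin n) a → toℕ z % n ≡ a % n → z ≡ a mod n
  mod-≡ z a eq = trans (sym (toℕ-mod-id z)) (mod-cong (toℕ z) a eq)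

  +-mod-injective : ∀ p {a b} → a < n → b < n → (p + a) mod n ≡ (p + b) mod n → a ≡ b
  +-mod-injective p {a} {b} a<n b<n eq = begin
    a       ≡⟨ m<n⇒m%n≡m a<n ⟨
    a % n   ≡⟨ %-cancelˡ-+ p a b (trans (sym (toℕ-mod (p + a))) (trans (cong toℕ eq) (toℕ-mod (p + b)))) ⟩
    b % n   ≡⟨ m<n⇒m%n≡m b<n ⟩
    b       ∎

  diffMod-spec : ∀ (z u : Fin n) → (toℕ u + diffMod n z u) % n ≡ toℕ z
  diffMod-spec z u = begin
    (toℕ u + (toℕ z + n ∸ toℕ u) % n) % n    ≡⟨ +-comm-under-% ⟩
    ((toℕ z + n ∸ toℕ u) % n + toℕ u) % n    ≡⟨ [m%n+k]%n≡[m+k]%n (toℕ z + n ∸ toℕ u) (toℕ u) ⟩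
    (toℕ z + n ∸ toℕ u + toℕ u) % n          ≡⟨ cong (_% n) (m∸n+n≡m u≤z+n) ⟩
    (toℕ z + n) % n                           ≡⟨ [m+n]%n≡m%n (toℕ z) n ⟩
    toℕ z % n                                 ≡⟨ toℕ-%-id z ⟩
    toℕ z                                     ∎
    where
      +-comm-under-% = cong (_% n) (+-comm (toℕ u) _)
      u≤z+n : toℕ u ≤ toℕ z + n
      u≤z+n = ≤-trans (<⇒≤ (toℕ<n u)) (m≤n+m n (toℕ z))

  diffMod-unique : ∀ (z u : Fin n) {d} → d < n → (toℕ u + d) % n ≡ toℕ z → diffMod n z u ≡ d
  diffMod-unique z u {d} d<n eq = begin
    diffMod n z u             ≡⟨ m<n⇒m%n≡m (m%n<n _ n) ⟨
    diffMod n z u % n         ≡⟨ %-cancelˡ-+ (toℕ u) (diffMod n z u) d (trans (diffMod-spec z u) (sym eq)) ⟩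
    d % n                     ≡⟨ m<n⇒m%n≡m d<n ⟩
    d                         ∎

  adjDistances : List ℕ
  adjDistances = 1 ∷ 3 ∷ n ∸ 1 ∷ n ∸ 3 ∷ []

  T-adjᵇ⇔ : ∀ u z → T (adjᵇ n u z) ⇔ diffMod n u z ∈ₗ adjDistances
  T-adjᵇ⇔ u z = mk⇔
    (λ t → Any.map (≡ᵇ⇒≡ d _) (any⁻ (d ≡ᵇ_) adjDistances (subst T adjᵇ≡any t)))
    (λ d∈ → subst T (sym adjᵇ≡any) (any⁺ (d ≡ᵇ_) (Any.map (≡⇒≡ᵇ d _) d∈)))
    where
      d = diffMod n u z
      adjᵇ≡any : adjᵇ n u z ≡ any (d ≡ᵇ_) adjDistances
      adjᵇ≡any = cong (λ b → (d ≡ᵇ 1) ∨ (d ≡ᵇ 3) ∨ (d ≡ᵇ (n ∸ 1)) ∨ b) (sym (∨-identityʳ _))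

  closedNbhd-self : ∀ u → u ∈ closedNbhd n u
  closedNbhd-self u = Equivalence.from (∈-tabulate⇔ _)
    (Equivalence.from T-∨ (inj₁ (≡⇒≡ᵇ _ 0 diff≡0)))
    where
      diff≡0 : diffMod n u u ≡ 0
      diff≡0 = diffMod-unique u u (>-nonZero⁻¹ n)
        (trans (cong (_% n) (+-identityʳ (toℕ u))) (toℕ-%-id u))

  closedNbhd-adj : ∀ u z → diffMod n u z ∈ₗ adjDistances → z ∈ closedNbhd n u
  closedNbhd-adj u z d∈ = Equivalence.from (∈-tabulate⇔ _)
    (Equivalence.from (T-∨ {diffMod n z u ≡ᵇ 0}) (inj₂ (Equivalence.from (T-adjᵇ⇔ u z) d∈)))

  closedNbhd⁻ : ∀ u z → z ∈ closedNbhd n u → z ≡ u ⊎ diffMod n u z ∈ₗ adjDistances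
  closedNbhd⁻ u z z∈ with Equivalence.to T-∨ (Equivalence.to (∈-tabulate⇔ _) z∈)
  ... | inj₁ t = inj₁ (toℕ-injective (begin
          toℕ z                             ≡⟨ diffMod-spec z u ⟨
          (toℕ u + diffMod n z u) % n       ≡⟨ cong (λ d → (toℕ u + d) % n) (≡ᵇ⇒≡ _ 0 t) ⟩
          (toℕ u + 0) % n                   ≡⟨ cong (_% n) (+-identityʳ (toℕ u)) ⟩
          toℕ u % n                         ≡⟨ toℕ-%-id u ⟩
          toℕ u                             ∎))
  ... | inj₂ t = inj₂ (Equivalence.to (T-adjᵇ⇔ u z) t)

  module _ (3<n : 3 < n) (p : ℕ) {c : ℕ} (3≤c : 3 ≤ c) where

    private
      u : Fin n
      u = (p + c) mod n

      1≤c : 1 ≤ c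
      1≤c = ≤-trans (from-yes (1 ≤? 3)) 3≤c

      1≤n : 1 ≤ n
      1≤n = >-nonZero⁻¹ n

      3≤n : 3 ≤ n
      3≤n = <⇒≤ 3<n

      back : ∀ k → k ≤ c → (p + (c ∸ k) + k) % n ≡ (p + c) % n
      back k k≤c = cong (_% n) (trans (+-assoc p (c ∸ k) k) (cong (p +_) (m∸n+n≡m k≤c)))

      ahead : ∀ k → k ≤ n → (p + (c + k) + (n ∸ k)) % n ≡ (p + c) % n
      ahead k k≤n = begin
        (p + (c + k) + (n ∸ k)) % n     ≡⟨ cong (λ m → (m + (n ∸ k)) % n) (+-assoc p c k) ⟨
        (p + c + k + (n ∸ k)) % n       ≡⟨ cong (_% n) (+-assoc (p + c) k (n ∸ k)) ⟩
        (p + c + (k + (n ∸ k))) % n     ≡⟨ cong (λ m → (p + c + m) % n) (m+[n∸m]≡n k≤n) ⟩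
        (p + c + n) % n                 ≡⟨ [m+n]%n≡m%n (p + c) n ⟩
        (p + c) % n                     ∎

      adjacent : ∀ j {d} → d < n → d ∈ₗ adjDistances → (p + j + d) % n ≡ (p + c) % n →
                 (p + j) mod n ∈ closedNbhd n u
      adjacent j {d} d<n d∈ eq = closedNbhd-adj u _ (subst (_∈ₗ adjDistances) (sym diff≡d) d∈)
        where
          diff≡d : diffMod n u ((p + j) mod n) ≡ d
          diff≡d = diffMod-unique u _ d<n (begin
            (toℕ ((p + j) mod n) + d) % n   ≡⟨ cong (λ m → (m + d) % n) (toℕ-mod (p + j)) ⟩
            ((p + j) % n + d) % n           ≡⟨ [m%n+k]%n≡[m+k]%n (p + j) d ⟩
            (p + j + d) % n                 ≡⟨ eq ⟩
            (p + c) % n                     ≡⟨ toℕ-mod (p + c) ⟨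
            toℕ u                           ∎)

      located : ∀ z j {d} → diffMod n u z ≡ d → (p + j + d) % n ≡ (p + c) % n → z ≡ (p + j) mod n
      located z j {d} diff≡d eq = mod-≡ z (p + j) (%-cancelʳ-+ d (toℕ z) (p + j) (begin
        (toℕ z + d) % n                 ≡⟨ cong (λ m → (toℕ z + m) % n) diff≡d ⟨
        (toℕ z + diffMod n u z) % n     ≡⟨ diffMod-spec u z ⟩
        toℕ u                           ≡⟨ toℕ-mod (p + c) ⟩
        (p + c) % n                     ≡⟨ eq ⟨
        (p + j + d) % n                 ∎))

    ∈-closedNbhd⁺ : ∀ {j} → j ∈ₗ nbrs c → (p + j) mod n ∈ closedNbhd n u
    ∈-closedNbhd⁺ (here refl) =
      adjacent (c ∸ 3) 3<n (there (here refl)) (back 3 3≤c)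
    ∈-closedNbhd⁺ (there (here refl)) =
      adjacent (c ∸ 1) (<-trans (from-yes (1 <? 3)) 3<n) (here refl) (back 1 1≤c)
    ∈-closedNbhd⁺ (there (there (here refl))) =
      closedNbhd-self u
    ∈-closedNbhd⁺ (there (there (there (here refl)))) =
      adjacent (c + 1) (∸-monoʳ-< (s≤s z≤n) 1≤n) (there (there (here refl))) (ahead 1 1≤n)
    ∈-closedNbhd⁺ (there (there (there (there (here refl))))) =
      adjacent (c + 3) (∸-monoʳ-< (s≤s z≤n) 3≤n) (there (there (there (here refl)))) (ahead 3 3≤n)

    ∈-closedNbhd⁻ : ∀ {z} → z ∈ closedNbhd n u → Any (λ j → z ≡ (p + j) mod n) (nbrs c)
    ∈-closedNbhd⁻ {z} z∈ with closedNbhd⁻ u z z∈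
    ... | inj₁ z≡u                = there (there (here z≡u))
    ... | inj₂ (here d≡1)         = there (here (located z (c ∸ 1) d≡1 (back 1 1≤c)))
    ... | inj₂ (there (here d≡3)) = here (located z (c ∸ 3) d≡3 (back 3 3≤c))
    ... | inj₂ (there (there (here d≡n∸1))) =
      there (there (there (here (located z (c + 1) d≡n∸1 (ahead 1 1≤n)))))
    ... | inj₂ (there (there (there (here d≡n∸3)))) =
      there (there (there (there (here (located z (c + 3) d≡n∸3 (ahead 3 3≤n))))))

  module Code (S : Subset n) where

    coded : ℕ → Bool
    coded q = lookup S (q mod n)

    Coded : ℕ → ℕ → Set
    Coded p j = T (coded (p + j))

    module _ (L : IsLocatingCode n S) (3<n : 3 < n) (p : ℕ) where

      private
        coded-mod : ∀ {z j} → z ≡ (p + j) mod n → z ∈ S → Coded p j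
        coded-mod refl z∈S = Equivalence.to (∈⇔T-lookup S) z∈S

        inclusion : ∀ {c c′} → 3 ≤ c → 3 ≤ c′ → (∀ {j} → j ∈ₗ nbrs c ∖ nbrs c′ → ¬ Coded p j) →
                    closedNbhd n ((p + c) mod n) ∩ S ⊆ closedNbhd n ((p + c′) mod n)
        inclusion {c} {c′} 3≤c 3≤c′ uncoded z∈ with x∈p∩q⁻ _ S z∈
        ... | z∈N , z∈S with find (∈-closedNbhd⁻ 3<n p 3≤c z∈N)
        ... | j , j∈ , refl = ∈-closedNbhd⁺ 3<n p 3≤c′ (decidable-stable (j ∈? nbrs c′)
                (λ j∉ → uncoded (∈-filter⁺ (_∉? nbrs c′) j∈ j∉) (coded-mod refl z∈S)))

      dominated : ∀ {c} → 3 ≤ c → Any (Coded p) (nbrs c)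
      dominated {c} 3≤c with T? (coded (p + c))
      ... | yes u∈S = there (there (here u∈S))
      ... | no u∉S with proj₁ L _ (u∉S ∘ Equivalence.to (∈⇔T-lookup S))
      ... | z , z∈ with x∈p∩q⁻ _ S z∈
      ... | z∈N , z∈S = Any.map (λ z≡ → coded-mod z≡ z∈S) (∈-closedNbhd⁻ 3<n p 3≤c z∈N)

      separated : ∀ {c c′} → 3 ≤ c → 3 ≤ c′ → c < n → c′ < n → c ∉ₗ nbrs c′ → c′ ∉ₗ nbrs c →
                  Any (Coded p) (nbrs c △ nbrs c′)
      separated {c} {c′} 3≤c 3≤c′ c<n c′<n c∉ c′∉
        with any? (λ j → T? (coded (p + j))) (nbrs c △ nbrs c′)
      ... | yes found = found
      ... | no none = ⊥-elim (proj₂ L u w u∉S w∉S u≢w traces-equal)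
        where
          u = (p + c) mod n
          w = (p + c′) mod n
          self : ∀ a → a ∈ₗ nbrs a
          self a = there (there (here refl))
          uncodedˡ : ∀ {j} → j ∈ₗ nbrs c ∖ nbrs c′ → ¬ Coded p j
          uncodedˡ j∈ t = none (lose (∈-++⁺ˡ j∈) t)
          uncodedʳ : ∀ {j} → j ∈ₗ nbrs c′ ∖ nbrs c → ¬ Coded p j
          uncodedʳ j∈ t = none (lose (∈-++⁺ʳ (nbrs c ∖ nbrs c′) j∈) t)
          u∉S : u ∉ S
          u∉S u∈S = uncodedˡ (∈-filter⁺ (_∉? nbrs c′) (self c) c∉) (Equivalence.to (∈⇔T-lookup S) u∈S)
          w∉S : w ∉ S
          w∉S w∈S = uncodedʳ (∈-filter⁺ (_∉? nbrs c) (self c′) c′∉) (Equivalence.to (∈⇔T-lookup S) w∈S)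
          u≢w : u ≢ w
          u≢w u≡w = c∉ (subst (_∈ₗ nbrs c′) (sym (+-mod-injective p c<n c′<n u≡w)) (self c′))
          traces-equal : trace n S u ≡ trace n S w
          traces-equal = ∩-≡ (inclusion 3≤c 3≤c′ uncodedˡ) (inclusion 3≤c′ 3≤c uncodedʳ)

module _ {n : ℕ} .{{_ : NonZero n}} (S : Subset n) (L : IsLocatingCode n S) (7<n : 7 < n) where

  open Code S

  private
    3<n : 3 < n
    3<n = <-trans (from-yes (3 <? 7)) 7<n

    window : ∀ k → ℕ → Vec Bool k
    window k p = tabulate (λ i → coded (p + toℕ i))

    window-locallyLocating : ∀ p → T (locallyLocating (window 11 p))
    window-locallyLocating p = Equivalence.from T-∧
      ( any⁺ (coded ∘ (p +_)) (dominated L 3<n p (from-yes (3 ≤? 7)))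
      , Equivalence.from T-∧
          (any⁺ (coded ∘ (p +_)) (separatedFrom7 5) , any⁺ (coded ∘ (p +_)) (separatedFrom7 3)))
      where
        separatedFrom7 : ∀ c → {True (3 ≤? c)} → {True (c <? 7)} →
                         {False (7 ∈? nbrs c)} → {False (c ∈? nbrs 7)} →
                         Any (Coded p) (nbrs 7 △ nbrs c)
        separatedFrom7 c {3≤c} {c<7} {7∉} {c∉} =
          separated L 3<n p (from-yes (3 ≤? 7)) (toWitness 3≤c) 7<n (<-trans (toWitness c<7) 7<n)
            (toWitnessFalse 7∉) (toWitnessFalse c∉)

    Φ : ℕ → ℕ
    Φ p = potential (window 10 p)

    -- init (window 11 p) and last (window 11 p) compute to window 10 p and coded (p + 10).
    Φ-step : ∀ p → Φ (suc p) < Φ p + 3 * 𝟙 (coded (10 + p))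
    Φ-step p = subst₂ (λ w b → potential w < Φ p + 3 * 𝟙 b) tail-window (cong coded (+-comm p 10))
      (potential-step (window 11 p) (window-locallyLocating p))
      where
        tail-window : tail (window 11 p) ≡ window 10 (suc p)
        tail-window = tabulate-cong (λ i → cong coded (+-suc p (toℕ i)))

    coded-periodic : ∀ i → coded (n + i) ≡ coded i
    coded-periodic i =
      cong (lookup S) (mod-cong (n + i) i (trans (cong (_% n) (+-comm n i)) ([m+n]%n≡m%n i n)))

    Φ-periodic : Φ n ≡ Φ 0
    Φ-periodic = cong potential (tabulate-cong (λ i → coded-periodic (toℕ i)))

  locatingCode-bound : n ≤ 3 * ∣ S ∣
  locatingCode-bound = begin
    n                                ≤⟨ cyclic-potential-bound 3 Φ entering Φ-step n Φ-periodic ⟩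
    3 * sum (applyUpTo entering n)   ≡⟨ cong (3 *_) entering-total ⟩
    3 * ∣ S ∣                        ∎
    where
      open ≤-Reasoning
      entering : ℕ → ℕ
      entering p = 𝟙 (coded (10 + p))
      entering-total : sum (applyUpTo entering n) ≡ ∣ S ∣
      entering-total = trans (sum-applyUpTo-rotate (𝟙 ∘ coded) n (cong 𝟙 ∘ coded-periodic) 10)
        (sum-applyUpTo-count S (𝟙 ∘ coded) (cong (𝟙 ∘ lookup S) ∘ toℕ-mod-id))

theorem1 : (n : ℕ) .{{_ : NonZero n}} → 13 ≤ n →
    (S : Subset n) → IsLocatingCode n S → n ≤ 3 * ∣ S ∣
theorem1 n 13≤n S L = locatingCode-bound S L (<-≤-trans (from-yes (7 <? 13)) 13≤n)
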